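{- Let $i$ be a positive integer and let $G$ be a graph of order $n$ whose average degree $d:=d(G)$ satisfies $d\ge 2i$. Then $G$ contains at least $\frac{dn}{4(i+1)\Delta(G)}$ vertex-disjoint $i$-stars.
   Context: An $i$-star is the complete bipartite graph $K_{1,i}$. $\Delta(G)$ denotes the maximum degree of $G$. -}

module Defs where

open import Data.Nat using (ℕ; zero; suc; _+_; _*_; _⊔_; _≤_)
open import Data.Fin using (Fin; zero; suc)
open import Data.Bool using (Bool; true; false; if_then_else_)
open import Data.List using (List; map; foldr; allFin)
open import Data.Nat.ListAction using (sum)
open import Data.Product using (_×_; Σ; ∃)
open import Relation.Binary.PropositionalEquality using (_≡_)

record Graph (n : ℕ) : Set where
  field
    adj   : Fin n → Fin n → Bool
    sym   : ∀ u v → adj u v ≡ adj v u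
    irrefl : ∀ v → adj v v ≡ false
open Graph public

degree : ∀ {n} → Graph n → Fin n → ℕ
degree {n} G u = sum (map (λ v → if adj G u v then 1 else 0) (allFin n))

-- sum of all degrees (= 2|E(G)| = d(G) * n)
degreeSum : ∀ {n} → Graph n → ℕ
degreeSum {n} G = sum (map (degree G) (allFin n))

maxDegree : ∀ {n} → Graph n → ℕ
maxDegree {n} G = foldr _⊔_ 0 (map (degree G) (allFin n))

-- k vertex-disjoint i-stars in G: star j has centre f j zero and leaves
-- f j (suc t), t : Fin i; all (k * (i+1)) vertices are pairwise distinct,
-- and each centre is adjacent to each of its leaves.
DisjointStars : ∀ {n} → Graph n → (i k : ℕ) → Set
DisjointStars {n} G i k =
  Σ (Fin k → Fin (suc i) → Fin n) λ f →
    (∀ a b c d → f a b ≡ f c d → (a ≡ c) × (b ≡ d)) ×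
    (∀ j (t : Fin i) → adj G (f j zero) (f j (suc t)) ≡ true)

{-# OPTIONS --safe #-}
-- Greedily take i-stars centred at an unmarked vertex with at least i unmarked
-- neighbours, and mark their vertices, until no such centre is left. Each star raises the
-- volume (degree sum) of the marked set M by at most (i+1)Δ, so k stars give
-- vol M ≤ k(i+1)Δ. In the degree sum dn, the edges into M contribute vol M, the remaining
-- edges at vertices of M at most vol M, and every unmarked vertex has fewer than i
-- unmarked neighbours, so dn ≤ 2 vol M + in ≤ 2 vol M + dn/2, i.e. dn ≤ 4k(i+1)Δ.
module Submission where

open import Defs hiding (sym)
open import Data.Nat using (ℕ; zero; suc; _+_; _*_; _⊔_; _≤_; _<_; z≤n; s≤s; _≤?_)
open import Data.Nat.Properties
  using ( ≤-refl; ≤-reflexive; ≤-trans; ≤-pred; <-≤-trans; <⇒≤; ≰⇒>; m≤m+n; m≤n+m; m≤m⊔n; m≤n⇒m≤o⊔n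
        ; +-comm; +-assoc; +-identityʳ; *-comm; *-assoc; *-identityʳ; *-distribˡ-+
        ; +-mono-≤; +-monoʳ-≤; +-mono-<-≤; +-mono-≤-<; +-cancelʳ-≤; *-monoʳ-≤
        ; +-0-commutativeMonoid; module ≤-Reasoning )
open import Data.Nat.Tactic.RingSolver using (solve-∀)
import Data.Nat.ListAction as List
open import Data.Fin using (Fin; zero; suc)
open import Data.Fin.Properties using (_≟_; any?; suc-injective)
open import Data.Bool using (Bool; true; false; if_then_else_; not; _∧_; _∨_)
open import Data.Bool.Properties using (∨-zeroʳ) renaming (_≟_ to _≟ᵇ_)
open import Data.List using (List; map; foldr; allFin; tabulate)
open import Data.List.Properties using (map-tabulate)
open import Data.List.Membership.Propositional using (_∈_)
open import Data.List.Membership.Propositional.Properties using (∈-map⁺; ∈-allFin)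
open import Data.List.Relation.Unary.Any using (here; there)
open import Data.Vec.Functional using (_∷_)
open import Data.Product using (Σ; _×_; _,_; proj₁; proj₂; map₁)
open import Data.Empty using (⊥-elim)
open import Function using (_∘_; id)
open import Function.Definitions using (Injective)
open import Relation.Nullary using (does; yes; no)
open import Relation.Nullary.Decidable using (dec-true; _×-dec_)
open import Relation.Binary.PropositionalEquality
open import Algebra.Properties.CommutativeMonoid.Sum +-0-commutativeMonoid
  using (sum; sum-syntax; sum-cong-≗; ∑-distrib-+; ∑-comm; sum-replicate-zero)

private
  variable
    k m n : ℕ
    A : Set

∑-mono-≤ : {f g : Fin n → ℕ} → (∀ v → f v ≤ g v) → sum f ≤ sum g
∑-mono-≤ {zero}  f≤g = z≤n
∑-mono-≤ {suc n} f≤g = +-mono-≤ (f≤g zero) (∑-mono-≤ (f≤g ∘ suc))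

∑-mono-< : {f g : Fin n → ℕ} → (∀ v → f v ≤ g v) → ∀ c → f c < g c → sum f < sum g
∑-mono-< f≤g zero    fc<gc = +-mono-<-≤ fc<gc (∑-mono-≤ (f≤g ∘ suc))
∑-mono-< f≤g (suc c) fc<gc = +-mono-≤-< (f≤g zero) (∑-mono-< (f≤g ∘ suc) c fc<gc)

∑-const : ∀ n c → ∑[ _ < n ] c ≡ n * c
∑-const zero    c = refl
∑-const (suc n) c = cong (c +_) (∑-const n c)

sum-map-allFin : (f : Fin n → ℕ) → List.sum (map f (allFin n)) ≡ sum f
sum-map-allFin {n} f = trans (cong List.sum (map-tabulate id f)) (sum-tabulate f)
  where
  sum-tabulate : ∀ {n} (f : Fin n → ℕ) → List.sum (tabulate f) ≡ sum f
  sum-tabulate {zero}  f = refl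
  sum-tabulate {suc n} f = cong (f zero +_) (sum-tabulate (f ∘ suc))

∈⇒≤foldr-⊔ : ∀ {x} {xs : List ℕ} → x ∈ xs → x ≤ foldr _⊔_ 0 xs
∈⇒≤foldr-⊔ (here refl) = m≤m⊔n _ _
∈⇒≤foldr-⊔ (there x∈xs) = m≤n⇒m≤o⊔n _ (∈⇒≤foldr-⊔ x∈xs)

restrict : (Fin n → ℕ) → (Fin n → Bool) → Fin n → ℕ
restrict w S v = if S v then w v else 0

weight : (Fin n → ℕ) → (Fin n → Bool) → ℕ
weight w S = sum (restrict w S)

count : (Fin n → Bool) → ℕ
count = weight (λ _ → 1)

infixr 6 _∪_
infixr 7 _∩_

_∪_ _∩_ : (Fin n → Bool) → (Fin n → Bool) → Fin n → Bool
(S ∪ T) v = S v ∨ T v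
(S ∩ T) v = S v ∧ T v

∁ : (Fin n → Bool) → Fin n → Bool
∁ S v = not (S v)

⁅_⁆ : Fin n → Fin n → Bool
⁅ c ⁆ v = does (c ≟ v)

image : (Fin k → Fin n) → Fin n → Bool
image {zero}  h v = false
image {suc k} h v = (⁅ h zero ⁆ ∪ image (h ∘ suc)) v

∈-∪ˡ : ∀ (S T : Fin n → Bool) {v} → S v ≡ true → (S ∪ T) v ≡ true
∈-∪ˡ S T Sv rewrite Sv = refl

∈-∪ʳ : ∀ (S T : Fin n → Bool) {v} → T v ≡ true → (S ∪ T) v ≡ true
∈-∪ʳ S T Tv rewrite Tv = ∨-zeroʳ (S _)

∈-∁∩ : ∀ (S T : Fin n → Bool) v → (∁ S ∩ T) v ≡ true → S v ≡ false × T v ≡ true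
∈-∁∩ S T v v∈ with S v | T v
... | false | true = refl , refl

∈-image : (h : Fin k → Fin n) → ∀ b → image h (h b) ≡ true
∈-image h zero    = ∈-∪ˡ ⁅ h zero ⁆ (image (h ∘ suc)) (dec-true (h zero ≟ h zero) refl)
∈-image h (suc b) = ∈-∪ʳ ⁅ h zero ⁆ (image (h ∘ suc)) (∈-image (h ∘ suc) b)

weight-∪ : ∀ (w : Fin n → ℕ) S T → weight w (S ∪ T) ≤ weight w S + weight w T
weight-∪ w S T = begin
  weight w (S ∪ T)                                 ≤⟨ ∑-mono-≤ (λ v → if-∨ (S v) (T v) (w v)) ⟩
  sum (λ v → restrict w S v + restrict w T v)       ≡⟨ ∑-distrib-+ (restrict w S) (restrict w T) ⟩
  weight w S + weight w T                          ∎
  where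
  open ≤-Reasoning
  if-∨ : ∀ a b x → (if a ∨ b then x else 0) ≤ (if a then x else 0) + (if b then x else 0)
  if-∨ true  b x = m≤m+n x _
  if-∨ false b x = ≤-refl

weight-⁅⁆ : ∀ (w : Fin n → ℕ) c → weight w ⁅ c ⁆ ≡ w c
weight-⁅⁆ {suc n} w zero    = trans (cong (w zero +_) (sum-replicate-zero n)) (+-identityʳ _)
weight-⁅⁆         w (suc c) = weight-⁅⁆ (w ∘ suc) c

weight-image : ∀ (w : Fin n → ℕ) (h : Fin k → Fin n) → weight w (image h) ≤ ∑[ b < k ] w (h b)
weight-image {n = n} {k = zero} w h = ≤-reflexive (sum-replicate-zero n)
weight-image {k = suc k} w h = begin
  weight w (image h)                                   ≤⟨ weight-∪ w ⁅ h zero ⁆ (image (h ∘ suc)) ⟩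
  weight w ⁅ h zero ⁆ + weight w (image (h ∘ suc))     ≤⟨ +-mono-≤ (≤-reflexive (weight-⁅⁆ w (h zero)))
                                                                    (weight-image w (h ∘ suc)) ⟩
  w (h zero) + ∑[ b < k ] w (h (suc b))                ∎
  where open ≤-Reasoning

weight-split : ∀ (w : Fin n → ℕ) S T → weight w T ≡ weight w (S ∩ T) + weight w (∁ S ∩ T)
weight-split w S T =
  trans (sum-cong-≗ split) (∑-distrib-+ (restrict w (S ∩ T)) (restrict w (∁ S ∩ T)))
  where
  split : ∀ v → restrict w T v ≡ restrict w (S ∩ T) v + restrict w (∁ S ∩ T) v
  split v with S v
  ... | true  = sym (+-identityʳ _)
  ... | false = refl

count≤n : (S : Fin n → Bool) → count S ≤ n
count≤n {n} S = begin
  count S       ≤⟨ ∑-mono-≤ (λ v → indicator≤1 (S v)) ⟩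
  ∑[ _ < n ] 1  ≡⟨ trans (∑-const n 1) (*-identityʳ n) ⟩
  n             ∎
  where
  open ≤-Reasoning
  indicator≤1 : ∀ b → (if b then 1 else 0) ≤ 1
  indicator≤1 true  = ≤-refl
  indicator≤1 false = z≤n

count-∁-∪-< : ∀ (S T : Fin n → Bool) {c} → S c ≡ false → T c ≡ true →
              count (∁ (S ∪ T)) < count (∁ S)
count-∁-∪-< S T {c} Sc Tc = ∑-mono-< (λ v → mono (S v) (T v)) c (strict (S c) (T c) Sc Tc)
  where
  mono : ∀ a b → (if not (a ∨ b) then 1 else 0) ≤ (if not a then 1 else 0)
  mono true  b     = ≤-refl
  mono false true  = z≤n
  mono false false = ≤-refl
  strict : ∀ a b → a ≡ false → b ≡ true →
           (if not (a ∨ b) then 1 else 0) < (if not a then 1 else 0)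
  strict false true _ _ = s≤s z≤n

∷-injective : ∀ {x : A} {g : Fin k → A} → Injective _≡_ _≡_ g → (∀ t → g t ≢ x) →
              Injective _≡_ _≡_ (x ∷ g)
∷-injective g-inj g≢x {zero}  {zero}  _  = refl
∷-injective g-inj g≢x {zero}  {suc t} eq = ⊥-elim (g≢x t (sym eq))
∷-injective g-inj g≢x {suc s} {zero}  eq = ⊥-elim (g≢x s eq)
∷-injective g-inj g≢x {suc s} {suc t} eq = cong suc (g-inj eq)

select : ∀ k (p : Fin n → Bool) → k ≤ count p →
         Σ (Fin k → Fin n) λ g → Injective _≡_ _≡_ g × (∀ t → p (g t) ≡ true)
select zero p _ = (λ ()) , (λ { {()} }) , (λ ())
select {suc n} (suc k) p k≤count with p zero in p0
... | true  = let g , g-inj , g-p = select k (p ∘ suc) (≤-pred k≤count) in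
  zero ∷ suc ∘ g , ∷-injective (g-inj ∘ suc-injective) (λ _ ())
                 , λ { zero → p0 ; (suc t) → g-p t }
... | false = let g , g-inj , g-p = select (suc k) (p ∘ suc) k≤count in
  suc ∘ g , g-inj ∘ suc-injective , g-p

Disjoint : (Fin k → Fin m → A) → Set
Disjoint f = ∀ a b c d → f a b ≡ f c d → (a ≡ c) × (b ≡ d)

∷-disjoint : {s : Fin m → A} {f : Fin k → Fin m → A} → Injective _≡_ _≡_ s →
             (∀ b a d → s b ≢ f a d) → Disjoint f → Disjoint (s ∷ f)
∷-disjoint s-inj s∉f f-disj zero    b zero    d eq = refl , s-inj eq
∷-disjoint s-inj s∉f f-disj zero    b (suc c) d eq = ⊥-elim (s∉f b c d eq)
∷-disjoint s-inj s∉f f-disj (suc a) b zero    d eq = ⊥-elim (s∉f d a b (sym eq))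
∷-disjoint s-inj s∉f f-disj (suc a) b (suc c) d eq = map₁ (cong suc) (f-disj a b c d eq)

module _ {n} (G : Graph n) where

  volume : (Fin n → Bool) → ℕ
  volume = weight (degree G)

  freeDegree : (Fin n → Bool) → Fin n → ℕ
  freeDegree M u = count (∁ M ∩ adj G u)

  degree≡count : ∀ u → degree G u ≡ count (adj G u)
  degree≡count u = sum-map-allFin (restrict (λ _ → 1) (adj G u))

  degree≤maxDegree : ∀ u → degree G u ≤ maxDegree G
  degree≤maxDegree u = ∈⇒≤foldr-⊔ (∈-map⁺ (degree G) (∈-allFin u))

  volume-image : (h : Fin k → Fin n) → volume (image h) ≤ k * maxDegree G
  volume-image {k} h = begin
    volume (image h)               ≤⟨ weight-image (degree G) h ⟩
    ∑[ b < k ] degree G (h b)      ≤⟨ ∑-mono-≤ (degree≤maxDegree ∘ h) ⟩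
    ∑[ _ < k ] maxDegree G         ≡⟨ ∑-const k (maxDegree G) ⟩
    k * maxDegree G                ∎
    where open ≤-Reasoning

  degree-split : ∀ M u → degree G u ≡ count (M ∩ adj G u) + freeDegree M u
  degree-split M u = trans (degree≡count u) (weight-split (λ _ → 1) M (adj G u))

  freeDegree≤degree : ∀ M u → freeDegree M u ≤ degree G u
  freeDegree≤degree M u = subst (freeDegree M u ≤_) (sym (degree-split M u)) (m≤n+m _ _)

  ∑-count-∩-adj : ∀ M → ∑[ u < n ] count (M ∩ adj G u) ≡ volume M
  ∑-count-∩-adj M =
    trans (∑-comm (λ u → restrict (λ _ → 1) (M ∩ adj G u))) (sum-cong-≗ column)
    where
    column : ∀ v → ∑[ u < n ] restrict (λ _ → 1) (M ∩ adj G u) v ≡ restrict (degree G) M v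
    column v with M v
    ... | true  = trans (sum-cong-≗ (λ u → cong (λ b → if b then 1 else 0) (Graph.sym G u v)))
                        (sym (degree≡count v))
    ... | false = sum-replicate-zero n

  ∑-freeDegree≤ : ∀ M i → (∀ u → M u ≡ false → freeDegree M u ≤ i) →
                  ∑[ u < n ] freeDegree M u ≤ volume M + n * i
  ∑-freeDegree≤ M i unmarked≤i = begin
    ∑[ u < n ] freeDegree M u                ≤⟨ ∑-mono-≤ pointwise ⟩
    ∑[ u < n ] (restrict (degree G) M u + i) ≡⟨ ∑-distrib-+ (restrict (degree G) M) (λ _ → i) ⟩
    volume M + ∑[ _ < n ] i                  ≡⟨ cong (volume M +_) (∑-const n i) ⟩
    volume M + n * i                         ∎
    where
    open ≤-Reasoning
    pointwise : ∀ u → freeDegree M u ≤ restrict (degree G) M u + i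
    pointwise u with M u in Mu
    ... | true  = ≤-trans (freeDegree≤degree M u) (m≤m+n _ i)
    ... | false = unmarked≤i u Mu

  degreeSum≤ : ∀ M i → (∀ u → M u ≡ false → freeDegree M u ≤ i) →
               degreeSum G ≤ volume M + volume M + n * i
  degreeSum≤ M i unmarked≤i = begin
    degreeSum G
      ≡⟨ sum-map-allFin (degree G) ⟩
    ∑[ u < n ] degree G u
      ≡⟨ sum-cong-≗ (degree-split M) ⟩
    ∑[ u < n ] (count (M ∩ adj G u) + freeDegree M u)
      ≡⟨ ∑-distrib-+ (λ u → count (M ∩ adj G u)) (freeDegree M) ⟩
    ∑[ u < n ] count (M ∩ adj G u) + ∑[ u < n ] freeDegree M u
      ≤⟨ +-mono-≤ (≤-reflexive (∑-count-∩-adj M)) (∑-freeDegree≤ M i unmarked≤i) ⟩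
    volume M + (volume M + n * i)
      ≡⟨ +-assoc (volume M) _ _ ⟨
    volume M + volume M + n * i
      ∎
    where open ≤-Reasoning

module Greedy {n} (G : Graph n) (i : ℕ) where

  record Packing : Set where
    field
      size     : ℕ
      stars    : Fin size → Fin (suc i) → Fin n
      disjoint : Disjoint stars
      adjacent : ∀ j (t : Fin i) → adj G (stars j zero) (stars j (suc t)) ≡ true
      marked   : Fin n → Bool
      covered  : ∀ j b → marked (stars j b) ≡ true
      cost     : volume G marked ≤ size * (suc i * maxDegree G)

  open Packing public

  Extendable : (Fin n → Bool) → Fin n → Set
  Extendable M c = M c ≡ false × i ≤ freeDegree G M c

  Maximal : Packing → Set
  Maximal p = ∀ u → marked p u ≡ false → freeDegree G (marked p) u < i

  empty : Packing
  empty = record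
    { size = 0 ; stars = λ () ; disjoint = λ () ; adjacent = λ ()
    ; marked = λ _ → false ; covered = λ () ; cost = ≤-reflexive (sum-replicate-zero n) }

  extend : (p : Packing) → ∀ c → Extendable (marked p) c →
           Σ Packing λ p′ → count (∁ (marked p′)) < count (∁ (marked p))
  extend p c (c-unmarked , i≤free) with select i (∁ (marked p) ∩ adj G c) i≤free
  ... | leaf , leaf-injective , leaf-free =
    p′ , count-∁-∪-< (marked p) (image star) c-unmarked (∈-image star zero)
    where
    leaf-unmarked-adjacent : ∀ t → marked p (leaf t) ≡ false × adj G c (leaf t) ≡ true
    leaf-unmarked-adjacent t = ∈-∁∩ (marked p) (adj G c) (leaf t) (leaf-free t)

    star : Fin (suc i) → Fin n
    star = c ∷ leaf

    leaf≢c : ∀ t → leaf t ≢ c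
    leaf≢c t eq
      with () ← trans (sym (subst (λ v → adj G c v ≡ true) eq (proj₂ (leaf-unmarked-adjacent t))))
                      (irrefl G c)

    star-unmarked : ∀ b → marked p (star b) ≡ false
    star-unmarked zero    = c-unmarked
    star-unmarked (suc t) = proj₁ (leaf-unmarked-adjacent t)

    star∉stars : ∀ b a d → star b ≢ stars p a d
    star∉stars b a d eq
      with () ← trans (sym (star-unmarked b)) (trans (cong (marked p) eq) (covered p a d))

    cost′ : volume G (marked p ∪ image star) ≤ suc (size p) * (suc i * maxDegree G)
    cost′ = begin
      volume G (marked p ∪ image star)             ≤⟨ weight-∪ (degree G) (marked p) (image star) ⟩
      volume G (marked p) + volume G (image star)  ≤⟨ +-mono-≤ (cost p) (volume-image G star) ⟩
      size p * X + X                               ≡⟨ +-comm (size p * X) X ⟩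
      suc (size p) * X                             ∎
      where
      open ≤-Reasoning
      X : ℕ
      X = suc i * maxDegree G

    p′ : Packing
    p′ = record
      { size     = suc (size p)
      ; stars    = star ∷ stars p
      ; disjoint = ∷-disjoint (∷-injective leaf-injective leaf≢c) star∉stars (disjoint p)
      ; adjacent = λ { zero t → proj₂ (leaf-unmarked-adjacent t) ; (suc j) → adjacent p j }
      ; marked   = marked p ∪ image star
      ; covered  = λ { zero b → ∈-∪ʳ (marked p) (image star) (∈-image star b)
                     ; (suc j) b → ∈-∪ˡ (marked p) (image star) (covered p j b) }
      ; cost     = cost′
      }

  greedy : ∀ r (p : Packing) → count (∁ (marked p)) < r → Σ Packing Maximal
  greedy (suc r) p unmarked<r
    with any? (λ c → (marked p c ≟ᵇ false) ×-dec (i ≤? freeDegree G (marked p) c))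
  ... | no none = p , λ u u-unmarked → ≰⇒> (λ i≤free → none (u , u-unmarked , i≤free))
  ... | yes (c , ext) =
    let p′ , fewer = extend p c ext in greedy r p′ (<-≤-trans fewer (≤-pred unmarked<r))

  maximalPacking : Σ Packing Maximal
  maximalPacking = greedy (suc n) empty (s≤s (count≤n _))

m≤n+o⇒2o≤m⇒m≤2n : ∀ {m n o} → m ≤ n + o → 2 * o ≤ m → m ≤ 2 * n
m≤n+o⇒2o≤m⇒m≤2n {m} {n} {o} m≤n+o 2o≤m = +-cancelʳ-≤ m m (2 * n) (begin
  m + m          ≡⟨ cong (m +_) (+-identityʳ m) ⟨
  2 * m          ≤⟨ *-monoʳ-≤ 2 m≤n+o ⟩
  2 * (n + o)    ≡⟨ *-distribˡ-+ 2 n o ⟩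
  2 * n + 2 * o  ≤⟨ +-monoʳ-≤ (2 * n) 2o≤m ⟩
  2 * n + m      ∎)
  where open ≤-Reasoning

lemma20 : (i n : ℕ) → 1 ≤ i → 1 ≤ n → (G : Graph n) →
    2 * i * n ≤ degreeSum G →
    Σ ℕ (λ k → DisjointStars G i k × (degreeSum G ≤ k * (4 * (i + 1) * maxDegree G)))
lemma20 i n _ _ G 2in≤degreeSum = size p , (stars p , disjoint p , adjacent p) , bound
  where
  open Greedy G i

  p : Packing
  p = proj₁ maximalPacking

  V X : ℕ
  V = volume G (marked p)
  X = suc i * maxDegree G

  degreeSum≤4V : degreeSum G ≤ 2 * (V + V)
  degreeSum≤4V = m≤n+o⇒2o≤m⇒m≤2n {n = V + V} {o = n * i}
    (degreeSum≤ G (marked p) i (λ u u-unmarked → <⇒≤ (proj₂ maximalPacking u u-unmarked)))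
    (subst (_≤ degreeSum G) (trans (*-assoc 2 i n) (cong (2 *_) (*-comm i n))) 2in≤degreeSum)

  rearrange : ∀ k i Δ → 2 * (k * (suc i * Δ) + k * (suc i * Δ)) ≡ k * (4 * (i + 1) * Δ)
  rearrange = solve-∀

  bound : degreeSum G ≤ size p * (4 * (i + 1) * maxDegree G)
  bound = begin
    degreeSum G                           ≤⟨ degreeSum≤4V ⟩
    2 * (V + V)                           ≤⟨ *-monoʳ-≤ 2 (+-mono-≤ (cost p) (cost p)) ⟩
    2 * (size p * X + size p * X)         ≡⟨ rearrange (size p) i (maxDegree G) ⟩
    size p * (4 * (i + 1) * maxDegree G)  ∎
    where open ≤-Reasoning
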